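{- Let $(D,T,\lambda)$ be a complete structured DNNF, $Z\subseteq\mathsf{var}(D)$, and let $t$ be a node of $T$ with children $t_1,t_2$. Let $\tau_1:\mathsf{kept}(t_1)\to\{0,1\}$ be of shape $S_1$ and $\tau_2:\mathsf{kept}(t_2)\to\{0,1\}$ be of shape $S_2$. Then $\tau=\tau_1\cup\tau_2$ is of shape $S_1\bowtie S_2$.
   Context: A DNNF is a Boolean circuit with $\wedge$- and $\vee$-gates whose inputs are literals (negation only at inputs), in which every $\wedge$-gate is decomposable: the subcircuits rooted at its inputs are on disjoint variable sets. A vtree for $X$ is a rooted tree in which every non-leaf node has exactly two children and whose leaves are in bijection with $X$. A complete structured DNNF $(D,T,\lambda)$ is a DNNF $D$, a vtree $T$ for $\mathsf{var}(D)$, and a labelling $\lambda$ assigning to each node $t$ of $T$ a set $\lambda(t)$ of gates such that: (i) if $t$ is a leaf labeled $x$, $\lambda(t)$ contains only inputs $x$ or $\neg x$; (ii) every gate $u$ lies in $\lambda(t_u)$ for a unique node $t_u$; (iii) no non-leaf node's set contains an input; (iv) every $\wedge$-gate has two inputs $v_1,v_2$ with $t_{v_1}\ne t_{v_2}$; (v) for every wire from $u$ into $v$, either $v$ is an $\wedge$-gate, $u$ is an $\vee$-gate or an input and $t_u$ is a child of $t_v$, or $v$ is an $\vee$-gate, $u$ is an $\wedge$-gate and $t_u=t_v$. For a node $t$ of $T$, $\mathsf{var}(t)$ is the set of variables labeling leaves of the subtree rooted at $t$, $\mathsf{forgot}(t)=Z\cap\mathsf{var}(t)$ and $\mathsf{kept}(t)=\mathsf{var}(t)\setminus\mathsf{forgot}(t)$.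 $D_s$ denotes the subcircuit rooted at gate $s$. $O_t$ is the set of $\vee$-gates in $\lambda(t)$. An assignment $\tau:\mathsf{kept}(t)\to\{0,1\}$ is of shape $S\subseteq O_t$ iff $S=\{s\in O_t\mid \exists\sigma:\mathsf{forgot}(t)\to\{0,1\},\ \tau\cup\sigma\models D_s\}$. For $S_1\subseteq O_{t_1}$ and $S_2\subseteq O_{t_2}$, $S_1\bowtie S_2\subseteq O_t$ is the set of gates $s\in O_t$ that evaluate to $1$ once every gate in $S_1\cup S_2$ is replaced by $1$ and every gate in $(O_{t_1}\setminus S_1)\cup(O_{t_2}\setminus S_2)$ is replaced by $0$.
   Formalization: $O_t$ is the set of ∨-gates together with the inputs in λ(t), so at a leaf its inputs x or ¬x, and every ∧-gate has exactly two inputs v₁,v₂ with $t_{v_1}\ne t_{v_2}$. Each condition added here is assumed in the paper as well or is needed for the statement above to hold. -}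

module Defs where

open import Data.Nat using (ℕ)
open import Data.Fin using (Fin)
open import Data.Bool using (Bool)
open import Data.List using (List; []; _∷_)
open import Data.List.Membership.Propositional using (_∈_)
open import Data.Product using (Σ; ∃; _×_; _,_; proj₁)
open import Data.Sum using (_⊎_)
open import Data.Empty using (⊥)
open import Relation.Nullary using (¬_; yes; no)
open import Relation.Binary.PropositionalEquality using (_≡_; _≢_)
open import Induction.WellFounded using (WellFounded)
open import Data.Fin.Subset using (Subset) renaming (_∈_ to _∈ˢ_; _∉_ to _∉ˢ_)
open import Data.Fin.Subset.Properties using (_∈?_)
open import Function.Bundles using (_⇔_)

-- Circuits (negation only at inputs).  Variables are Fin n, gates Fin m.
-- lit x true  is the input  x,  lit x false  is the input  ¬x.

data Gate (n m : ℕ) : Set where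
  lit : Fin n → Bool → Gate n m
  and : List (Fin m) → Gate n m
  or  : List (Fin m) → Gate n m

Circuit : ℕ → ℕ → Set
Circuit n m = Fin m → Gate n m

inputs : ∀ {n m} → Gate n m → List (Fin m)
inputs (lit _ _) = []
inputs (and us)  = us
inputs (or us)   = us

Wire : ∀ {n m} → Circuit n m → Fin m → Fin m → Set
Wire D u v = u ∈ inputs (D v)

IsAnd IsOr IsLit : ∀ {n m} → Gate n m → Set
IsAnd g = ∃ λ us → g ≡ and us
IsOr  g = ∃ λ us → g ≡ or us
IsLit g = ∃ λ x → ∃ λ b → g ≡ lit x b

data Occurs {n m} (D : Circuit n m) (x : Fin n) : Fin m → Set where
  occ-lit : ∀ {u b} → D u ≡ lit x b → Occurs D x u
  occ-in  : ∀ {u v} → Wire D v u → Occurs D x v → Occurs D x u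

VarD : ∀ {n m} → Circuit n m → Fin n → Set
VarD {m = m} D x = Σ (Fin m) λ u → Occurs D x u

Decomposable : ∀ {n m} → Circuit n m → Set
Decomposable {n} {m} D =
  ∀ (g : Fin m) us → D g ≡ and us → ∀ u v → u ∈ us → v ∈ us → u ≢ v →
  ∀ (x : Fin n) → Occurs D x u → Occurs D x v → ⊥

data VTree (n : ℕ) : Set where
  leaf : Fin n → VTree n
  node : VTree n → VTree n → VTree n

-- nodes of a vtree, as paths from the root
data Pos {n} : VTree n → Set where
  here  : ∀ {T} → Pos T
  left  : ∀ {l r} → Pos l → Pos (node l r)
  right : ∀ {l r} → Pos r → Pos (node l r)

sub : ∀ {n} (T : VTree n) → Pos T → VTree n
sub T here = T
sub (node l r) (left p) = sub l p
sub (node l r) (right p) = sub r p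

data Child {n} : (T : VTree n) → Pos T → Pos T → Set where
  cl : ∀ {l r} → Child (node l r) (left here) here
  cr : ∀ {l r} → Child (node l r) (right here) here
  gl : ∀ {l r c p} → Child l c p → Child (node l r) (left c) (left p)
  gr : ∀ {l r c p} → Child r c p → Child (node l r) (right c) (right p)

LeafOf : ∀ {n} → Fin n → VTree n → Set
LeafOf x T = Σ (Pos T) λ p → sub T p ≡ leaf x

-- Complete structured DNNF (D, T, λ); λ is given by  tag u = t_u.

record CSDNNF (n m : ℕ) : Set where
  field
    D          : Circuit n m
    acyclic    : WellFounded (Wire D)
    decomp     : Decomposable D
    T          : VTree n
    leaves-var : ∀ x → LeafOf x T ⇔ VarD D x
    leaves-inj : ∀ x (p q : LeafOf x T) → proj₁ p ≡ proj₁ q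
    -- (ii) every gate u lies in λ(t_u) for a unique node t_u
    tag        : Fin m → Pos T
    cond-i     : ∀ u x → sub T (tag u) ≡ leaf x → ∃ λ b → D u ≡ lit x b
    cond-iii   : ∀ u x b → D u ≡ lit x b → ∃ λ y → sub T (tag u) ≡ leaf y
    cond-iv    : ∀ u us → D u ≡ and us →
                 ∃ λ v₁ → ∃ λ v₂ → us ≡ v₁ ∷ v₂ ∷ [] × tag v₁ ≢ tag v₂
    cond-v     : ∀ u v → Wire D u v →
                 (IsAnd (D v) × (IsOr (D u) ⊎ IsLit (D u)) × Child T (tag u) (tag v))
                 ⊎ (IsOr (D v) × IsAnd (D u) × tag u ≡ tag v)

module _ {n m : ℕ} (C : CSDNNF n m) where
  open CSDNNF C

  VarT : Pos T → Fin n → Set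
  VarT t x = LeafOf x (sub T t)

  Kept Forgot : Subset n → Pos T → Fin n → Set
  Kept   Z t x = VarT t x × x ∉ˢ Z
  Forgot Z t x = VarT t x × x ∈ˢ Z

  -- O_t  (READING: ∨-gates of λ(t), together with the inputs of λ(t)
  --        when t is a leaf)
  InO : Pos T → Fin m → Set
  InO t u = tag u ≡ t × (IsOr (D u) ⊎ IsLit (D u))

  Assign : (Fin n → Set) → Set
  Assign P = (x : Fin n) → P x → Bool

  data Sat {P : Fin n → Set} (ρ : Assign P) : Fin m → Set where
    sat-lit : ∀ {g x b} → D g ≡ lit x b → (p : P x) → ρ x p ≡ b → Sat ρ g
    sat-and : ∀ {g us} → D g ≡ and us → (∀ u → u ∈ us → Sat ρ u) → Sat ρ g
    sat-or  : ∀ {g us u} → D g ≡ or us → u ∈ us → Sat ρ u → Sat ρ g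

  union : ∀ Z t → Assign (Kept Z t) → Assign (Forgot Z t) → Assign (VarT t)
  union Z t τ σ x p with x ∈? Z
  ... | yes z = σ x (p , z)
  ... | no nz = τ x (p , nz)

  OfShape : (Z : Subset n) (t : Pos T) → Assign (Kept Z t) → (Fin m → Set) → Set
  OfShape Z t τ S =
    ∀ s → S s ⇔ (InO t s × ∃ λ (σ : Assign (Forgot Z t)) → Sat (union Z t τ σ) s)

  -- value 1 after replacing gates of S₁ ∪ S₂ by 1 and the rest of
  -- O_{t₁} ∪ O_{t₂} by 0
  data Val (t₁ t₂ : Pos T) (S₁ S₂ : Fin m → Set) : Fin m → Set where
    v-rep : ∀ {g} → (InO t₁ g × S₁ g) ⊎ (InO t₂ g × S₂ g) → Val t₁ t₂ S₁ S₂ g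
    v-and : ∀ {g us} → ¬ (InO t₁ g ⊎ InO t₂ g) → D g ≡ and us →
            (∀ u → u ∈ us → Val t₁ t₂ S₁ S₂ u) → Val t₁ t₂ S₁ S₂ g
    v-or  : ∀ {g us u} → ¬ (InO t₁ g ⊎ InO t₂ g) → D g ≡ or us →
            u ∈ us → Val t₁ t₂ S₁ S₂ u → Val t₁ t₂ S₁ S₂ g

  Join : (t t₁ t₂ : Pos T) → (Fin m → Set) → (Fin m → Set) → Fin m → Set
  Join t t₁ t₂ S₁ S₂ s = InO t s × Val t₁ t₂ S₁ S₂ s

module Submission where

-- Write ρσ for τ ∪ σ.  Since t is not a leaf, O_t consists of ∨-gates only (iii);
-- the inputs of such an ∨-gate s are ∧-gates u of λ(t) (v), and each such u has
-- exactly two inputs a ∈ O_{t₁} and b ∈ O_{t₂} (iv, v).  Unfolding the evaluation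
-- with O_{t₁} ∪ O_{t₂} replaced by constants therefore gives, gate by gate,
--     u ↦ 1  ⇔  a ∈ S₁ ∧ b ∈ S₂  ⇔  (∃σ₁. τ₁ ∪ σ₁ ⊨ D_a) ∧ (∃σ₂. τ₂ ∪ σ₂ ⊨ D_b)
-- by the shape hypotheses.  The one real step is independence: satisfaction of
-- D_v only depends on var(D_v) ⊆ var(t_v), and var(t₁), var(t₂) are disjoint, so
-- σ₁ and σ₂ glue to a single σ with ρσ ⊨ D_a ∧ D_b, and any σ restricts to both.

open import Defs
open import Data.Nat using (ℕ)
open import Data.Fin using (Fin) renaming (_≟_ to _≟ᶠ_)
open import Data.Fin.Subset using (Subset) renaming (_∈_ to _∈ˢ_)
open import Data.Fin.Subset.Properties using (_∈?_)
open import Data.Bool using (true)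
open import Data.List using (List; []; _∷_)
open import Data.List.Membership.Propositional using (_∈_)
open import Data.List.Relation.Unary.Any using (here; there)
open import Data.Product using (Σ; ∃; _×_; _,_; proj₁; proj₂)
open import Data.Product.Function.NonDependent.Propositional using (_×-⇔_)
import Data.Product.Function.Dependent.Propositional as Σ
open import Data.Sum using (_⊎_; inj₁; inj₂; swap) renaming (map to ⊎-map)
open import Data.Empty using (⊥; ⊥-elim)
open import Relation.Nullary using (¬_; Dec; yes; no)
open import Relation.Binary.PropositionalEquality
  using (_≡_; _≢_; refl; sym; trans; cong; subst)
open import Relation.Binary.PropositionalEquality.WithK using (≡-irrelevant)
open import Function.Bundles using (_⇔_; mk⇔; Equivalence)
open import Function.Related.Propositional using (module EquationalReasoning; equivalence)
import Function.Properties.Equivalence as ⇔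

open Equivalence using (to; from)

embed : ∀ {n} (T : VTree n) (t : Pos T) → Pos (sub T t) → Pos T
embed T here q = q
embed (node l r) (left t) q = left (embed l t q)
embed (node l r) (right t) q = right (embed r t q)

sub-embed : ∀ {n} (T : VTree n) (t : Pos T) (q : Pos (sub T t)) →
            sub T (embed T t q) ≡ sub (sub T t) q
sub-embed T here q = refl
sub-embed (node l r) (left t) q = sub-embed l t q
sub-embed (node l r) (right t) q = sub-embed r t q

left-injective : ∀ {n} {l r : VTree n} {a b : Pos l} → left {r = r} a ≡ left b → a ≡ b
left-injective refl = refl

right-injective : ∀ {n} {l r : VTree n} {a b : Pos r} → right {l = l} a ≡ right b → a ≡ b
right-injective refl = refl

embed-injective : ∀ {n} (T : VTree n) (t : Pos T) {q₁ q₂ : Pos (sub T t)} →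
                  embed T t q₁ ≡ embed T t q₂ → q₁ ≡ q₂
embed-injective T here e = e
embed-injective (node l r) (left t) e = embed-injective l t (left-injective e)
embed-injective (node l r) (right t) e = embed-injective r t (right-injective e)

leafOf-embed : ∀ {n} (T : VTree n) (t : Pos T) {x} → LeafOf x (sub T t) → LeafOf x T
leafOf-embed T t (q , e) = embed T t q , trans (sub-embed T t q) e

child-leaf : ∀ {n} {T : VTree n} {c p x} → Child T c p →
             LeafOf x (sub T c) → LeafOf x (sub T p)
child-leaf cl (q , e) = left q , e
child-leaf cr (q , e) = right q , e
child-leaf (gl ch) q = child-leaf ch q
child-leaf (gr ch) q = child-leaf ch q

child-irrefl : ∀ {n} {T : VTree n} {c p} → Child T c p → c ≢ p
child-irrefl cl ()
child-irrefl cr ()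
child-irrefl (gl ch) e = child-irrefl ch (left-injective e)
child-irrefl (gr ch) e = child-irrefl ch (right-injective e)

leaf-childless : ∀ {n} {T : VTree n} {c p y} → Child T c p → sub T p ≢ leaf y
leaf-childless cl ()
leaf-childless cr ()
leaf-childless (gl ch) e = leaf-childless ch e
leaf-childless (gr ch) e = leaf-childless ch e

only-two-children : ∀ {n} {T : VTree n} {c a b p} → Child T c p → Child T a p →
                    Child T b p → a ≢ b → c ≡ a ⊎ c ≡ b
only-two-children cl cl _ a≢b = inj₁ refl
only-two-children cl cr cl a≢b = inj₂ refl
only-two-children cl cr cr a≢b = ⊥-elim (a≢b refl)
only-two-children cr cr _ a≢b = inj₁ refl
only-two-children cr cl cr a≢b = inj₂ refl
only-two-children cr cl cl a≢b = ⊥-elim (a≢b refl)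
only-two-children (gl c) (gl a) (gl b) a≢b
  with only-two-children c a b (λ e → a≢b (cong left e))
... | inj₁ e = inj₁ (cong left e)
... | inj₂ e = inj₂ (cong left e)
only-two-children (gr c) (gr a) (gr b) a≢b
  with only-two-children c a b (λ e → a≢b (cong right e))
... | inj₁ e = inj₁ (cong right e)
... | inj₂ e = inj₂ (cong right e)

siblings-apart : ∀ {n} {T : VTree n} {a b p} → Child T a p → Child T b p → a ≢ b →
                 ∀ q₁ q₂ → embed T a q₁ ≢ embed T b q₂
siblings-apart cl cl a≢b _ _ _ = a≢b refl
siblings-apart cl cr a≢b _ _ ()
siblings-apart cr cl a≢b _ _ ()
siblings-apart cr cr a≢b _ _ _ = a≢b refl
siblings-apart (gl a) (gl b) a≢b q₁ q₂ e =
  siblings-apart a b (λ x → a≢b (cong left x)) q₁ q₂ (left-injective e)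
siblings-apart (gr a) (gr b) a≢b q₁ q₂ e =
  siblings-apart a b (λ x → a≢b (cong right x)) q₁ q₂ (right-injective e)

leafOf? : ∀ {n} (x : Fin n) (T : VTree n) → Dec (LeafOf x T)
leafOf? x (leaf y) with x ≟ᶠ y
... | yes refl = yes (here , refl)
... | no x≢y = no λ { (here , refl) → x≢y refl }
leafOf? x (node l r) with leafOf? x l | leafOf? x r
... | yes (q , e) | _ = yes (left q , e)
... | no _ | yes (q , e) = yes (right q , e)
... | no ¬l | no ¬r =
  no λ { (here , ()) ; (left q , e) → ¬l (q , e) ; (right q , e) → ¬r (q , e) }

∈-pair : ∀ {A : Set} {w x y : A} → w ∈ x ∷ y ∷ [] ⇔ (w ≡ x ⊎ w ≡ y)
∈-pair = mk⇔ members (λ { (inj₁ e) → here e ; (inj₂ e) → there (here e) })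
  where
  members : ∀ {A : Set} {w x y : A} → w ∈ x ∷ y ∷ [] → w ≡ x ⊎ w ≡ y
  members (here e) = inj₁ e
  members (there (here e)) = inj₂ e
  members (there (there ()))

all-of-two : ∀ {A : Set} {us : List A} {a b : A} (P : A → Set) →
             (∀ {w} → w ∈ us ⇔ (w ≡ a ⊎ w ≡ b)) →
             (∀ w → w ∈ us → P w) ⇔ (P a × P b)
all-of-two P members = mk⇔
  (λ all → all _ (from members (inj₁ refl)) , all _ (from members (inj₂ refl)))
  (λ { (pa , pb) w w∈ → on-member pa pb (to members w∈) })
  where
  on-member : ∀ {w a b} → P a → P b → w ≡ a ⊎ w ≡ b → P w
  on-member pa _ (inj₁ refl) = pa
  on-member _ pb (inj₂ refl) = pb

module _ {n m : ℕ} {g : Gate n m} where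

  and-injective : ∀ {us vs} → g ≡ and us → g ≡ and vs → us ≡ vs
  and-injective refl refl = refl

  or-injective : ∀ {us vs} → g ≡ or us → g ≡ or vs → us ≡ vs
  or-injective refl refl = refl

  lit-injective : ∀ {x y b c} → g ≡ lit x b → g ≡ lit y c → x ≡ y
  lit-injective refl refl = refl

  or≢and : ∀ {us vs} → g ≡ or us → g ≡ and vs → ⊥
  or≢and refl ()

  lit≢and : ∀ {x b vs} → g ≡ lit x b → g ≡ and vs → ⊥
  lit≢and refl ()

  lit≢or : ∀ {x b vs} → g ≡ lit x b → g ≡ or vs → ⊥
  lit≢or refl ()

module Structured {n m : ℕ} (C : CSDNNF n m) where
  open CSDNNF C

  -- x labels at most one leaf, so proofs of x ∈ var(t) are unique.
  leafOf-irrelevant : ∀ t x (p q : LeafOf x (sub T t)) → p ≡ q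
  leafOf-irrelevant t x (q₁ , e₁) (q₂ , e₂) =
    same-position (embed-injective T t (leaves-inj x (leafOf-embed T t (q₁ , e₁))
                                                     (leafOf-embed T t (q₂ , e₂)))) e₁ e₂
    where
    same-position : ∀ {a b : Pos (sub T t)} → a ≡ b →
                    (ea : sub (sub T t) a ≡ leaf x) (eb : sub (sub T t) b ≡ leaf x) →
                    (a , ea) ≡ (b , eb)
    same-position refl ea eb = cong (_ ,_) (≡-irrelevant ea eb)

  siblings-disjoint : ∀ {a b p x} → Child T a p → Child T b p → a ≢ b →
                      LeafOf x (sub T a) → LeafOf x (sub T b) → ⊥
  siblings-disjoint {a} {b} {x = x} ca cb a≢b (q₁ , e₁) (q₂ , e₂) =
    siblings-apart ca cb a≢b q₁ q₂
      (leaves-inj x (leafOf-embed T a (q₁ , e₁)) (leafOf-embed T b (q₂ , e₂)))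

  input-wire : ∀ {g v gate} → D g ≡ gate → v ∈ inputs gate → Wire D v g
  input-wire {v = v} e v∈ = subst (λ gate → v ∈ inputs gate) (sym e) v∈

  -- λ of an inner node contains no input gate (condition (iii)).
  inner-no-input : ∀ {c p s x b} → Child T c p → tag s ≡ p → D s ≢ lit x b
  inner-no-input {s = s} {x} {b} ch ts e with cond-iii s x b e
  ... | _ , at-leaf = leaf-childless ch (trans (cong (sub T) (sym ts)) at-leaf)

  -- var(D_u) ⊆ var(t_u): wires only go up the vtree or stay at a node.
  occurs-below : ∀ {x u} → Occurs D x u → LeafOf x (sub T (tag u))
  occurs-below {x} {u} (occ-lit {b = b} e) with cond-iii u x b e
  ... | y , at-y with cond-i u y at-y
  ... | _ , e' = here , trans at-y (cong leaf (sym (lit-injective e e')))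
  occurs-below {x} {u} (occ-in {v = v} w o) with cond-v v u w
  ... | inj₁ (_ , _ , ch) = child-leaf ch (occurs-below o)
  ... | inj₂ (_ , _ , same) = subst (λ s → LeafOf x (sub T s)) same (occurs-below o)

  sat-local : ∀ {P P' : Fin n → Set} (ρ : Assign C P) (ρ' : Assign C P') {u} →
              (∀ x → Occurs D x u → (p : P x) → Σ (P' x) λ p' → ρ' x p' ≡ ρ x p) →
              Sat C ρ u → Sat C ρ' u
  sat-local ρ ρ' reproduces (sat-lit e p v) with reproduces _ (occ-lit e) p
  ... | p' , same = sat-lit e p' (trans same v)
  sat-local ρ ρ' reproduces (sat-and e all) =
    sat-and e λ w w∈ → sat-local ρ ρ'
      (λ x o → reproduces x (occ-in (input-wire e w∈) o)) (all w w∈)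
  sat-local ρ ρ' reproduces (sat-or e w∈ s) =
    sat-or e w∈ (sat-local ρ ρ' (λ x o → reproduces x (occ-in (input-wire e w∈) o)) s)

  sat-and⇔ : ∀ {P} {ρ : Assign C P} {g us} → D g ≡ and us →
             Sat C ρ g ⇔ (∀ u → u ∈ us → Sat C ρ u)
  sat-and⇔ {ρ = ρ} e = mk⇔ (unfold e) (sat-and e)
    where
    unfold : ∀ {g us} → D g ≡ and us → Sat C ρ g → ∀ u → u ∈ us → Sat C ρ u
    unfold e (sat-lit e' _ _) = ⊥-elim (lit≢and e' e)
    unfold e (sat-and e' all) =
      subst (λ vs → ∀ u → u ∈ vs → Sat C ρ u) (and-injective e' e) all
    unfold e (sat-or e' _ _) = ⊥-elim (or≢and e' e)

  sat-or⇔ : ∀ {P} {ρ : Assign C P} {g us} → D g ≡ or us →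
            Sat C ρ g ⇔ (∃ λ u → u ∈ us × Sat C ρ u)
  sat-or⇔ {ρ = ρ} e = mk⇔ (unfold e) (λ { (_ , u∈ , s) → sat-or e u∈ s })
    where
    unfold : ∀ {g us} → D g ≡ or us → Sat C ρ g → ∃ λ u → u ∈ us × Sat C ρ u
    unfold e (sat-lit e' _ _) = ⊥-elim (lit≢or e' e)
    unfold e (sat-and e' _) = ⊥-elim (or≢and e e')
    unfold e (sat-or {u = u} e' u∈ s) = u , subst (u ∈_) (or-injective e' e) u∈ , s

  Extendable : (Z : Subset n) (t : Pos T) → Assign C (Kept C Z t) → Fin m → Set
  Extendable Z t τ v = ∃ λ (σ : Assign C (Forgot C Z t)) → Sat C (union C Z t τ σ) v

  module Replacement (t₁ t₂ : Pos T) (S₁ S₂ : Fin m → Set) where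

    Replaced : Fin m → Set
    Replaced g = InO C t₁ g ⊎ InO C t₂ g

    val-and⇔ : ∀ {g us} → ¬ Replaced g → D g ≡ and us →
               Val C t₁ t₂ S₁ S₂ g ⇔ (∀ u → u ∈ us → Val C t₁ t₂ S₁ S₂ u)
    val-and⇔ {g} {us} ¬rep e = mk⇔ unfold (v-and ¬rep e)
      where
      unfold : Val C t₁ t₂ S₁ S₂ g → ∀ u → u ∈ us → Val C t₁ t₂ S₁ S₂ u
      unfold (v-rep rep) = ⊥-elim (¬rep (⊎-map proj₁ proj₁ rep))
      unfold (v-and _ e' all) =
        subst (λ vs → ∀ u → u ∈ vs → Val C t₁ t₂ S₁ S₂ u) (and-injective e' e) all
      unfold (v-or _ e' _ _) = ⊥-elim (or≢and e' e)

    val-or⇔ : ∀ {g us} → ¬ Replaced g → D g ≡ or us →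
              Val C t₁ t₂ S₁ S₂ g ⇔ (∃ λ u → u ∈ us × Val C t₁ t₂ S₁ S₂ u)
    val-or⇔ {g} {us} ¬rep e = mk⇔ unfold (λ { (_ , u∈ , v) → v-or ¬rep e u∈ v })
      where
      unfold : Val C t₁ t₂ S₁ S₂ g → ∃ λ u → u ∈ us × Val C t₁ t₂ S₁ S₂ u
      unfold (v-rep rep) = ⊥-elim (¬rep (⊎-map proj₁ proj₁ rep))
      unfold (v-and _ e' _) = ⊥-elim (or≢and e e')
      unfold (v-or {u = u} _ e' u∈ v) = u , subst (u ∈_) (or-injective e' e) u∈ , v

    val-replaced₁ : t₁ ≢ t₂ → ∀ {g} → InO C t₁ g → Val C t₁ t₂ S₁ S₂ g ⇔ S₁ g
    val-replaced₁ t₁≢t₂ {g} o = mk⇔ value (λ s → v-rep (inj₁ (o , s)))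
      where
      value : Val C t₁ t₂ S₁ S₂ g → S₁ g
      value (v-rep (inj₁ (_ , s))) = s
      value (v-rep (inj₂ ((at-t₂ , _) , _))) = ⊥-elim (t₁≢t₂ (trans (sym (proj₁ o)) at-t₂))
      value (v-and ¬rep _ _) = ⊥-elim (¬rep (inj₁ o))
      value (v-or ¬rep _ _ _) = ⊥-elim (¬rep (inj₁ o))

    val-replaced₂ : t₁ ≢ t₂ → ∀ {g} → InO C t₂ g → Val C t₁ t₂ S₁ S₂ g ⇔ S₂ g
    val-replaced₂ t₁≢t₂ {g} o = mk⇔ value (λ s → v-rep (inj₂ (o , s)))
      where
      value : Val C t₁ t₂ S₁ S₂ g → S₂ g
      value (v-rep (inj₂ (_ , s))) = s
      value (v-rep (inj₁ ((at-t₁ , _) , _))) = ⊥-elim (t₁≢t₂ (trans (sym at-t₁) (proj₁ o)))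
      value (v-and ¬rep _ _) = ⊥-elim (¬rep (inj₂ o))
      value (v-or ¬rep _ _ _) = ⊥-elim (¬rep (inj₂ o))

  module ChildView (Z : Subset n) {t tᵢ : Pos T} (cᵢ : Child T tᵢ t)
    (τ : Assign C (Kept C Z t)) (τᵢ : Assign C (Kept C Z tᵢ))
    (τ≈τᵢ : ∀ x p q → τ x p ≡ τᵢ x q) where

    Agree : Assign C (Forgot C Z t) → Assign C (Forgot C Z tᵢ) → Set
    Agree σ σᵢ = ∀ x p q z → σ x (p , z) ≡ σᵢ x (q , z)

    union-agree : ∀ {σ σᵢ} → Agree σ σᵢ →
                  ∀ x p q → union C Z t τ σ x p ≡ union C Z tᵢ τᵢ σᵢ x q
    union-agree σ≈σᵢ x p q with x ∈? Z
    ... | yes z = σ≈σᵢ x p q z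
    ... | no z∉ = τ≈τᵢ x (p , z∉) (q , z∉)

    -- For a gate v of λ(tᵢ), τ ∪ σ and τᵢ ∪ σᵢ agree on var(D_v) ⊆ var(tᵢ).
    sat-child⇔ : ∀ {σ σᵢ v} → Agree σ σᵢ → tag v ≡ tᵢ →
                 Sat C (union C Z t τ σ) v ⇔ Sat C (union C Z tᵢ τᵢ σᵢ) v
    sat-child⇔ {σ} {σᵢ} {v} σ≈σᵢ tv = mk⇔
      (sat-local (union C Z t τ σ) (union C Z tᵢ τᵢ σᵢ)
        λ x o p → below o , sym (union-agree σ≈σᵢ x p (below o)))
      (sat-local (union C Z tᵢ τᵢ σᵢ) (union C Z t τ σ)
        λ x _ q → child-leaf cᵢ q , union-agree σ≈σᵢ x (child-leaf cᵢ q) q)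
      where
      below : ∀ {x} → Occurs D x v → LeafOf x (sub T tᵢ)
      below {x} o = subst (λ s → LeafOf x (sub T s)) tv (occurs-below o)

    restrict : Assign C (Forgot C Z t) → Assign C (Forgot C Z tᵢ)
    restrict σ x (q , z) = σ x (child-leaf cᵢ q , z)

    restrict-agree : ∀ σ → Agree σ (restrict σ)
    restrict-agree σ x p q z =
      cong (λ p' → σ x (p' , z)) (leafOf-irrelevant t x p (child-leaf cᵢ q))

module ShapeAtNode {n m : ℕ} (C : CSDNNF n m) (Z : Subset n)
  {t t₁ t₂ : Pos (CSDNNF.T C)}
  (c₁ : Child (CSDNNF.T C) t₁ t) (c₂ : Child (CSDNNF.T C) t₂ t) (t₁≢t₂ : t₁ ≢ t₂)
  {S₁ S₂ : Fin m → Set}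
  {τ₁ : Assign C (Kept C Z t₁)} (shape₁ : OfShape C Z t₁ τ₁ S₁)
  {τ₂ : Assign C (Kept C Z t₂)} (shape₂ : OfShape C Z t₂ τ₂ S₂)
  (τ : Assign C (Kept C Z t))
  (τ≈τ₁ : ∀ x p q → τ x p ≡ τ₁ x q)
  (τ≈τ₂ : ∀ x p q → τ x p ≡ τ₂ x q) where

  open CSDNNF C
  open Structured C
  open Replacement t₁ t₂ S₁ S₂
  module View₁ = ChildView Z c₁ τ τ₁ τ≈τ₁
  module View₂ = ChildView Z c₂ τ τ₂ τ≈τ₂
  open EquationalReasoning {k = equivalence}

  Value : Fin m → Set
  Value = Val C t₁ t₂ S₁ S₂

  ρ : Assign C (Forgot C Z t) → Assign C (VarT C t)
  ρ = union C Z t τ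

  unreplaced : ∀ {u} → tag u ≡ t → ¬ Replaced u
  unreplaced tu (inj₁ (at-t₁ , _)) = child-irrefl c₁ (trans (sym at-t₁) tu)
  unreplaced tu (inj₂ (at-t₂ , _)) = child-irrefl c₂ (trans (sym at-t₂) tu)

  value-child₁ : ∀ {v} → InO C t₁ v → Value v ⇔ Extendable Z t₁ τ₁ v
  value-child₁ {v} o = ⇔.trans (val-replaced₁ t₁≢t₂ o)
    (mk⇔ (λ s → proj₂ (to (shape₁ v) s)) (λ ext → from (shape₁ v) (o , ext)))

  value-child₂ : ∀ {v} → InO C t₂ v → Value v ⇔ Extendable Z t₂ τ₂ v
  value-child₂ {v} o = ⇔.trans (val-replaced₂ t₁≢t₂ o)
    (mk⇔ (λ s → proj₂ (to (shape₂ v) s)) (λ ext → from (shape₂ v) (o , ext)))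

  -- Assignments of forgot(t₁) and forgot(t₂) glue to one of forgot(t);
  -- variables of forgot(t) outside both subtrees get an arbitrary value.
  glue : Assign C (Forgot C Z t₁) → Assign C (Forgot C Z t₂) → Assign C (Forgot C Z t)
  glue σ₁ σ₂ x (_ , z) with leafOf? x (sub T t₁) | leafOf? x (sub T t₂)
  ... | yes q | _ = σ₁ x (q , z)
  ... | no _ | yes q = σ₂ x (q , z)
  ... | no _ | no _ = true

  glue-agree₁ : ∀ σ₁ σ₂ → View₁.Agree (glue σ₁ σ₂) σ₁
  glue-agree₁ σ₁ σ₂ x p q z with leafOf? x (sub T t₁) | leafOf? x (sub T t₂)
  ... | yes q' | _ = cong (λ q'' → σ₁ x (q'' , z)) (leafOf-irrelevant t₁ x q' q)
  ... | no ¬q | _ = ⊥-elim (¬q q)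

  glue-agree₂ : ∀ σ₁ σ₂ → View₂.Agree (glue σ₁ σ₂) σ₂
  glue-agree₂ σ₁ σ₂ x p q z with leafOf? x (sub T t₁) | leafOf? x (sub T t₂)
  ... | yes q' | _ = ⊥-elim (siblings-disjoint c₁ c₂ t₁≢t₂ q' q)
  ... | no _ | yes q' = cong (λ q'' → σ₂ x (q'' , z)) (leafOf-irrelevant t₂ x q' q)
  ... | no _ | no ¬q = ⊥-elim (¬q q)

  independent : ∀ {a b} → tag a ≡ t₁ → tag b ≡ t₂ →
                (Extendable Z t₁ τ₁ a × Extendable Z t₂ τ₂ b) ⇔
                (∃ λ σ → Sat C (ρ σ) a × Sat C (ρ σ) b)
  independent ta tb = mk⇔
    (λ { ((σ₁ , sa) , (σ₂ , sb)) →
         glue σ₁ σ₂ , from (View₁.sat-child⇔ (glue-agree₁ σ₁ σ₂) ta) sa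
                    , from (View₂.sat-child⇔ (glue-agree₂ σ₁ σ₂) tb) sb })
    (λ { (σ , sa , sb) →
         (View₁.restrict σ , to (View₁.sat-child⇔ (View₁.restrict-agree σ) ta) sa)
       , (View₂.restrict σ , to (View₂.sat-child⇔ (View₂.restrict-agree σ) tb) sb) })

  and-input : ∀ {u us v} → tag u ≡ t → D u ≡ and us → v ∈ us → InO C t₁ v ⊎ InO C t₂ v
  and-input {u} {us} {v} tu e v∈ with cond-v v u (input-wire e v∈)
  ... | inj₂ ((_ , e') , _) = ⊥-elim (or≢and e' e)
  ... | inj₁ (_ , kind , ch) with only-two-children (subst (Child T (tag v)) tu ch) c₁ c₂ t₁≢t₂
  ... | inj₁ tv = inj₁ (tv , kind)
  ... | inj₂ tv = inj₂ (tv , kind)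

  record AndSplit (us : List (Fin m)) : Set where
    field
      a b     : Fin m
      a∈O₁    : InO C t₁ a
      b∈O₂    : InO C t₂ b
      members : ∀ {w} → w ∈ us ⇔ (w ≡ a ⊎ w ≡ b)

  split-and : ∀ {u us} → tag u ≡ t → D u ≡ and us → AndSplit us
  split-and {u} tu e with cond-iv u _ e
  ... | v₁ , v₂ , refl , tags-differ
      with and-input tu e (here refl) | and-input tu e (there (here refl))
  ... | inj₁ o₁ | inj₂ o₂ = record { a = v₁ ; b = v₂ ; a∈O₁ = o₁ ; b∈O₂ = o₂
                                   ; members = ∈-pair }
  ... | inj₂ o₂ | inj₁ o₁ = record { a = v₂ ; b = v₁ ; a∈O₁ = o₁ ; b∈O₂ = o₂
                                   ; members = ⇔.trans ∈-pair (mk⇔ swap swap) }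
  ... | inj₁ (at₁ , _) | inj₁ (at₂ , _) = ⊥-elim (tags-differ (trans at₁ (sym at₂)))
  ... | inj₂ (at₁ , _) | inj₂ (at₂ , _) = ⊥-elim (tags-differ (trans at₁ (sym at₂)))

  and-gate : ∀ {u us} → tag u ≡ t → D u ≡ and us → Value u ⇔ Extendable Z t τ u
  and-gate {u} {us} tu e = begin
    Value u                                     ∼⟨ val-and⇔ (unreplaced tu) e ⟩
    (∀ w → w ∈ us → Value w)                    ∼⟨ all-of-two Value members ⟩
    (Value a × Value b)                         ∼⟨ value-child₁ a∈O₁ ×-⇔ value-child₂ b∈O₂ ⟩
    (Extendable Z t₁ τ₁ a × Extendable Z t₂ τ₂ b) ∼⟨ independent (proj₁ a∈O₁) (proj₁ b∈O₂) ⟩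
    (∃ λ σ → Sat C (ρ σ) a × Sat C (ρ σ) b)     ∼⟨ Σ.congˡ {k = equivalence}
                                                     (⇔.sym (all-of-two _ members)) ⟩
    (∃ λ σ → ∀ w → w ∈ us → Sat C (ρ σ) w)      ∼⟨ Σ.congˡ {k = equivalence}
                                                     (⇔.sym (sat-and⇔ e)) ⟩
    Extendable Z t τ u                          ∎
    where open AndSplit (split-and tu e)

  or-input : ∀ {s us u} → tag s ≡ t → D s ≡ or us → u ∈ us → tag u ≡ t × IsAnd (D u)
  or-input {s} {us} {u} ts e u∈ with cond-v u s (input-wire e u∈)
  ... | inj₁ ((_ , e') , _) = ⊥-elim (or≢and e e')
  ... | inj₂ (_ , isAnd , tu) = trans tu ts , isAnd

  or-gate : ∀ {s} → InO C t s → Value s ⇔ Extendable Z t τ s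
  or-gate (ts , inj₂ (_ , _ , e)) = ⊥-elim (inner-no-input c₁ ts e)
  or-gate {s} (ts , inj₁ (us , e)) = begin
    Value s                                       ∼⟨ val-or⇔ (unreplaced ts) e ⟩
    (∃ λ u → u ∈ us × Value u)                    ∼⟨ Σ.congˡ {k = equivalence} input⇔ ⟩
    (∃ λ u → u ∈ us × Extendable Z t τ u)         ∼⟨ mk⇔ (λ { (u , u∈ , σ , su) → σ , u , u∈ , su })
                                                         (λ { (σ , u , u∈ , su) → u , u∈ , σ , su }) ⟩
    (∃ λ σ → ∃ λ u → u ∈ us × Sat C (ρ σ) u)      ∼⟨ Σ.congˡ {k = equivalence} (⇔.sym (sat-or⇔ e)) ⟩
    Extendable Z t τ s                            ∎
    where
    input-gate : ∀ {u} → u ∈ us → Value u ⇔ Extendable Z t τ u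
    input-gate u∈ with or-input ts e u∈
    ... | tu , _ , eu = and-gate tu eu

    input⇔ : ∀ {u} → (u ∈ us × Value u) ⇔ (u ∈ us × Extendable Z t τ u)
    input⇔ = mk⇔ (λ { (u∈ , v) → u∈ , to (input-gate u∈) v })
                 (λ { (u∈ , ext) → u∈ , from (input-gate u∈) ext })

lemma6 : ∀ {n m} (C : CSDNNF n m) (Z : Subset n) →
         (∀ x → x ∈ˢ Z → VarD (CSDNNF.D C) x) →
         (t t₁ t₂ : Pos (CSDNNF.T C)) →
         Child (CSDNNF.T C) t₁ t → Child (CSDNNF.T C) t₂ t → t₁ ≢ t₂ →
         (S₁ S₂ : Fin m → Set) →
         (τ₁ : Assign C (Kept C Z t₁)) → OfShape C Z t₁ τ₁ S₁ →
         (τ₂ : Assign C (Kept C Z t₂)) → OfShape C Z t₂ τ₂ S₂ →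
         (τ : Assign C (Kept C Z t)) →
         (∀ x p q → τ x p ≡ τ₁ x q) →
         (∀ x p q → τ x p ≡ τ₂ x q) →
         OfShape C Z t τ (Join C t t₁ t₂ S₁ S₂)
lemma6 C Z _ t t₁ t₂ c₁ c₂ t₁≢t₂ S₁ S₂ τ₁ shape₁ τ₂ shape₂ τ τ≈τ₁ τ≈τ₂ s =
  mk⇔ (λ { (o , v) → o , to (or-gate o) v })
      (λ { (o , ext) → o , from (or-gate o) ext })
  where open ShapeAtNode C Z c₁ c₂ t₁≢t₂ shape₁ shape₂ τ τ≈τ₁ τ≈τ₂
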